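{- Let $n\geq 4$ and $2\leq k\leq n-2$. The number of permutations $\pi\in\mathcal{S}_n$ such that $\pi^2$ has exactly one descent and that descent is at position $k$ is at least \[\sum_{i=1}^{\lfloor\frac{n-1}{2}\rfloor} e_{n-(2i+1)},\] where $e_j$ denotes the number of involutions in $\mathcal{S}_j$ (with $e_0=1$).
   Context: $\mathcal{S}_n$ is the symmetric group on $[n]$; a permutation $\sigma=\sigma_1\cdots\sigma_n$ (one-line notation) has a descent at position $i\in[n-1]$ if $\sigma_i>\sigma_{i+1}$. $\pi^2(i)=\pi(\pi(i))$. An involution is a permutation $\tau$ with $\tau^2$ the identity. -}

module Defs where

open import Data.Nat using (ℕ; zero; suc; _∸_; _*_; _+_; _/_; _<_; _<ᵇ_)
import Data.Nat.Properties as ℕP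
open import Data.Fin using (Fin; zero; suc; toℕ; _≟_)
open import Data.Fin.Properties using (all?)
open import Data.List using (List; []; _∷_; [_]; map; concatMap; filter; length; upTo; allFin)
import Data.List.Properties as LP
open import Data.Nat.ListAction using (sum)
open import Data.Product using (_×_)
open import Relation.Nullary using (Dec; yes; no)
open import Relation.Nullary.Decidable using (_→-dec_; _×-dec_)
open import Relation.Binary.PropositionalEquality using (_≡_)
open import Function using (_∘_)
open import Data.Bool using (if_then_else_)

allFuns : (m n : ℕ) → List (Fin m → Fin n)
allFuns zero    n = [ (λ ()) ]
allFuns (suc m) n =
  concatMap (λ a → map (λ f → λ { zero → a ; (suc i) → f i }) (allFuns m n))
            (allFin n)

-- A function Fin n → Fin n is a permutation of [n] iff it is injective
-- (on a finite set injective ⇔ bijective).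
IsPerm : ∀ {n} → (Fin n → Fin n) → Set
IsPerm {n} f = (i j : Fin n) → f i ≡ f j → i ≡ j

isPerm? : ∀ {n} (f : Fin n → Fin n) → Dec (IsPerm f)
isPerm? f = all? (λ i → all? (λ j → (f i ≟ f j) →-dec (i ≟ j)))

IsInvolution : ∀ {n} → (Fin n → Fin n) → Set
IsInvolution {n} f = (i : Fin n) → f (f i) ≡ i

isInvolution? : ∀ {n} (f : Fin n → Fin n) → Dec (IsInvolution f)
isInvolution? f = all? (λ i → f (f i) ≟ i)

-- Descent set (1-indexed positions i ∈ [n-1] with σ_i > σ_{i+1}) of a
-- sequence σ : Fin n → ℕ, listed in increasing order.
descents : ∀ {n} → (Fin n → ℕ) → List ℕ
descents {zero}        σ = []
descents {suc zero}    σ = []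
descents {suc (suc n)} σ =
  let rest = map suc (descents {suc n} (σ ∘ suc)) in
  if σ (suc zero) <ᵇ σ zero then 1 ∷ rest else rest

OneDescentAt : ∀ {n} → ℕ → (Fin n → Fin n) → Set
OneDescentAt k π = descents (toℕ ∘ π ∘ π) ≡ k ∷ []

oneDescentAt? : ∀ {n} (k : ℕ) (π : Fin n → Fin n) → Dec (OneDescentAt k π)
oneDescentAt? k π = LP.≡-dec ℕP._≟_ (descents (toℕ ∘ π ∘ π)) (k ∷ [])

countOneDescentSq : ℕ → ℕ → ℕ
countOneDescentSq n k =
  length (filter (λ π → isPerm? π ×-dec oneDescentAt? k π) (allFuns n n))

e : ℕ → ℕ
e j = length (filter (λ τ → isPerm? τ ×-dec isInvolution? τ) (allFuns j j))

lowerBound : ℕ → ℕ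
lowerBound n = sum (map (λ i → e (n ∸ (2 * i + 1))) (map suc (upTo ((n ∸ 1) / 2))))

module Submission where

-- Write n = m + 3 and k = q + 2; positions are 0-based, so a descent at k means
-- π²(k − 1) > π²(k). Split the positions into a block B of three consecutive ones
-- and its complement, numbered in increasing order by [m], and let π act on the
-- complement as an involution τ of [m] and on B as a 3-cycle c. Then π² is the
-- identity off B and c² on B, so it has exactly one descent, inside B; for
-- B = {q+1, q+2, q+3} with c = (i ↦ i+1), and for B = {q, q+1, q+2} with
-- c = (i ↦ i−1), it is at k. The first family moves position q+1 up and the second
-- moves it down, and both are injective in τ, so there are at least 2 e_m such π.
-- The bound is e_m + (e_{m−2} + e_{m−4} + …), and the tail is at most e_m by
-- induction from e_{j+2} ≥ 2 e_j, which is the same construction with a block of two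
-- positions on which π is the identity or the swap.

open import Defs
open import Level using (0ℓ)
open import Data.Bool using (true; false; T; if_then_else_)
open import Data.Empty using (⊥-elim)
open import Data.Fin using (Fin; zero; suc; toℕ; fromℕ<; splitAt; _↑ˡ_; _↑ʳ_)
open import Data.Fin.Patterns using (0F; 1F; 2F)
open import Data.Fin.Properties
  using (injective⇒≤; any?; toℕ-injective; toℕ-↑ˡ; toℕ-↑ʳ; toℕ<n; fromℕ<-toℕ;
         splitAt-↑ˡ; splitAt-↑ʳ; splitAt⁻¹-↑ˡ; splitAt⁻¹-↑ʳ)
open import Data.List using (List; []; _∷_; map; concatMap; filter; length; lookup; allFin; upTo; applyUpTo)
open import Data.List.Properties using (length-map; map-upTo; map-∘; map-cong)
open import Data.List.Membership.Propositional.Properties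
  using (∈-allFin) renaming (∈-lookup to ∈ₚ-lookup)
open import Data.List.Membership.Setoid.Properties
  using (∈-lookup; ∈-map⁻; ∈-resp-≈; ∈-filter⁺; ∈-filter⁻)
import Data.List.Relation.Unary.All as All
import Data.List.Relation.Unary.All.Properties as All
open import Data.List.Relation.Unary.AllPairs using (AllPairs; []; _∷_)
import Data.List.Relation.Unary.AllPairs as AllPairs
import Data.List.Relation.Unary.AllPairs.Properties as AllPairs
open import Data.List.Relation.Unary.Any as Any using (Any; here)
open import Data.List.Relation.Unary.Any.Properties using (lookup-index; concatMap⁺; map⁺)
import Data.List.Relation.Unary.Unique.Setoid as UniqueSetoid
import Data.List.Relation.Unary.Unique.Setoid.Properties as Unique
open import Data.List.Relation.Unary.Unique.Propositional.Properties using (allFin⁺)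
open import Data.Nat using (ℕ; zero; suc; _+_; _*_; _∸_; _/_; _≤_; _<_; _<ᵇ_; z≤n; s≤s)
open import Data.Nat.DivMod using (m/n≡1+[m∸n]/n)
open import Data.Nat.ListAction using (sum)
open import Data.Nat.Properties
open import Algebra.Properties.CommutativeSemigroup +-commutativeSemigroup using (x∙yz≈y∙xz)
open import Data.Product as Product using (∃; _×_; _,_; proj₁; proj₂)
open import Data.Sum as Sum using (_⊎_; inj₁; inj₂)
import Data.Sum.Properties as Sum
open import Data.Unit using (tt)
open import Function using (_∘_; id; _⇔_; mk⇔; Equivalence)
open import Relation.Binary.Bundles using (Setoid)
open import Relation.Binary.Consequences using (resp⇒¬-resp)
open import Relation.Binary.Definitions using (_Respects_)
open import Relation.Binary.PropositionalEquality
open import Relation.Nullary using (¬_; does; yes; no; contradiction)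
open import Relation.Nullary.Decidable using (_×-dec_)
open import Relation.Unary using (Pred; Decidable; ∁)
open import Relation.Unary.Properties using (∁?)

module _ {c ℓ} (S : Setoid c ℓ) where
  open Setoid S using (_≈_) renaming (reflexive to ≈-reflexive; sym to ≈-sym; trans to ≈-trans)
  open import Data.List.Relation.Binary.Subset.Setoid S using (_⊆_)
  open UniqueSetoid S using (Unique)

  lookup-injective : ∀ {xs} → Unique xs → ∀ {i j} → lookup xs i ≈ lookup xs j → i ≡ j
  lookup-injective (_ ∷ _)    {zero}  {zero}  _   = refl
  lookup-injective (x≉xs ∷ _) {zero}  {suc j} x≈y = ⊥-elim (All.lookup x≉xs (∈ₚ-lookup j) x≈y)
  lookup-injective (x≉xs ∷ _) {suc i} {zero}  y≈x = ⊥-elim (All.lookup x≉xs (∈ₚ-lookup i) (≈-sym y≈x))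
  lookup-injective (_ ∷ xs!)  {suc i} {suc j} eq  = cong suc (lookup-injective xs! eq)

  unique⇒length≤ : ∀ {xs ys} → Unique xs → xs ⊆ ys → length xs ≤ length ys
  unique⇒length≤ {xs} {ys} xs! xs⊆ys = injective⇒≤ position-injective
    where
    position : Fin (length xs) → Fin (length ys)
    position i = Any.index (xs⊆ys (∈-lookup S xs i))

    position-injective : ∀ {i j} → position i ≡ position j → i ≡ j
    position-injective {i} {j} eq = lookup-injective xs!
      (≈-trans (lookup-index (xs⊆ys (∈-lookup S xs i)))
        (≈-trans (≈-reflexive (cong (lookup ys) eq)) (≈-sym (lookup-index (xs⊆ys (∈-lookup S xs j))))))

length-filter-∁ : ∀ {a p} {A : Set a} {P : Pred A p} (P? : Decidable P) xs →
  length (filter P? xs) + length (filter (∁? P?) xs) ≡ length xs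
length-filter-∁ P? []       = refl
length-filter-∁ P? (x ∷ xs) with does (P? x)
... | true  = cong suc (length-filter-∁ P? xs)
... | false = trans (+-suc _ _) (cong suc (length-filter-∁ P? xs))

Fn : ℕ → Set
Fn n = Fin n → Fin n

Funs : ℕ → ℕ → Setoid 0ℓ 0ℓ
Funs m n = Fin m →-setoid Fin n

-- allFuns extends functions by an anonymous pattern lambda, so the induction step is
-- stated for any cons with the same computation rules and instantiated by unification.
module _ {m n} {gs : List (Fin m → Fin n)} (cons : Fin n → (Fin m → Fin n) → Fin (suc m) → Fin n)
         (cons-zero : ∀ a g → cons a g zero ≡ a) (cons-suc : ∀ a g i → cons a g (suc i) ≡ g i) where

  concatMap-cons-complete : (∀ g → Any (g ≗_) gs) →
    ∀ f → Any (f ≗_) (concatMap (λ a → map (cons a) gs) (allFin n))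
  concatMap-cons-complete gs-complete f = concatMap⁺ _
    (Any.map (λ { refl → map⁺ (Any.map f≗cons (gs-complete (f ∘ suc))) }) (∈-allFin (f zero)))
    where
    f≗cons : ∀ {g} → f ∘ suc ≗ g → f ≗ cons (f zero) g
    f≗cons {g} eq zero    = sym (cons-zero (f zero) g)
    f≗cons {g} eq (suc i) = trans (eq i) (sym (cons-suc (f zero) g i))

  concatMap-cons-unique : AllPairs (λ g g′ → ¬ g ≗ g′) gs →
    AllPairs (λ f f′ → ¬ f ≗ f′) (concatMap (λ a → map (cons a) gs) (allFin n))
  concatMap-cons-unique gs! = Unique.concat⁺ (Funs (suc m) n)
    (All.map⁺ (All.tabulate (λ {a} _ → Unique.map⁺ (Funs m n) (Funs (suc m) n) (cons-injective a) gs!)))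
    (AllPairs.map⁺ {f = λ a → map (cons a) gs} (AllPairs.map disjoint (allFin⁺ n)))
    where
    cons-injective : ∀ a {g g′} → cons a g ≗ cons a g′ → g ≗ g′
    cons-injective a {g} {g′} eq i = trans (sym (cons-suc a g i)) (trans (eq (suc i)) (cons-suc a g′ i))

    disjoint : ∀ {a a′} → a ≢ a′ → ∀ {f} →
      ¬ (Any (f ≗_) (map (cons a) gs) × Any (f ≗_) (map (cons a′) gs))
    disjoint a≢a′ (f∈ , f∈′)
      with ∈-map⁻ (Funs m n) (Funs (suc m) n) f∈ | ∈-map⁻ (Funs m n) (Funs (suc m) n) f∈′
    ... | g , _ , f≗ | g′ , _ , f≗′ =
      a≢a′ (trans (sym (cons-zero _ g)) (trans (sym (f≗ zero)) (trans (f≗′ zero) (cons-zero _ g′))))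

allFuns-complete : ∀ m n (f : Fin m → Fin n) → Any (f ≗_) (allFuns m n)
allFuns-complete zero    n f = here (λ ())
allFuns-complete (suc m) n = concatMap-cons-complete _ (λ _ _ → refl) (λ _ _ _ → refl) (allFuns-complete m n)

allFuns-unique : ∀ m n → AllPairs (λ f g → ¬ f ≗ g) (allFuns m n)
allFuns-unique zero    n = All.[] ∷ []
allFuns-unique (suc m) n = concatMap-cons-unique _ (λ _ _ → refl) (λ _ _ _ → refl) (allFuns-unique m n)

∈-filter-allFuns : ∀ {n p} {P : Pred (Fn n) p} (P? : Decidable P) → P Respects _≗_ →
  ∀ {f} → P f → Any (f ≗_) (filter P? (allFuns n n))
∈-filter-allFuns {n} P? P-resp {f} = ∈-filter⁺ (Funs n n) P? P-resp (allFuns-complete n n f)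

IsPerm-resp : ∀ {n} → IsPerm {n} Respects _≗_
IsPerm-resp f≗g f-perm i j gi≡gj = f-perm i j (trans (f≗g i) (trans gi≡gj (sym (f≗g j))))

IsInvolution-resp : ∀ {n} → IsInvolution {n} Respects _≗_
IsInvolution-resp {x = f} {g} f≗g f-inv i = trans (sym (f≗g (g i))) (trans (cong f (sym (f≗g i))) (f-inv i))

leftInverse⇒isPerm : ∀ {n} {f g : Fn n} → (∀ i → g (f i) ≡ i) → IsPerm f
leftInverse⇒isPerm {g = g} g∘f≗id i j fi≡fj = trans (sym (g∘f≗id i)) (trans (cong g fi≡fj) (g∘f≗id j))

involution⇒isPerm : ∀ {n} {f : Fn n} → IsInvolution f → IsPerm f
involution⇒isPerm {f = f} = leftInverse⇒isPerm {g = f}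

involution? : ∀ {n} → Decidable (λ (τ : Fn n) → IsPerm τ × IsInvolution τ)
involution? τ = isPerm? τ ×-dec isInvolution? τ

involution-resp : ∀ {n} → (λ (τ : Fn n) → IsPerm τ × IsInvolution τ) Respects _≗_
involution-resp τ≗ = Product.map (IsPerm-resp τ≗) (IsInvolution-resp τ≗)

involutions : ∀ m → List (Fn m)
involutions m = filter involution? (allFuns m m)

e≤length : ∀ {m n} (F : Fn m → Fn n) → (∀ {τ τ′} → F τ ≗ F τ′ → τ ≗ τ′) → {ys : List (Fn n)} →
  (∀ τ → IsInvolution τ → Any (F τ ≗_) ys) → e m ≤ length ys
e≤length {m} {n} F F-injective {ys} F∈ys = begin
  e m                            ≡⟨ length-map F (involutions m) ⟨
  length (map F (involutions m)) ≤⟨ unique⇒length≤ (Funs n n) F[involutions]-unique F[involutions]⊆ys ⟩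
  length ys                      ∎
  where
  open ≤-Reasoning
  F[involutions]-unique : AllPairs (λ f g → ¬ f ≗ g) (map F (involutions m))
  F[involutions]-unique = Unique.map⁺ (Funs m m) (Funs n n) F-injective
    (Unique.filter⁺ (Funs m m) involution? (allFuns-unique m m))

  F[involutions]⊆ys : ∀ {f} → Any (f ≗_) (map F (involutions m)) → Any (f ≗_) ys
  F[involutions]⊆ys f∈ with ∈-map⁻ (Funs m m) (Funs n n) f∈
  ... | τ , τ∈ , f≗Fτ = ∈-resp-≈ (Funs n n) (λ i → sym (f≗Fτ i))
    (F∈ys τ (proj₂ (proj₂ (∈-filter⁻ (Funs m m) involution? involution-resp {xs = allFuns m m} τ∈))))

descents-cong : ∀ {n} {σ σ′ : Fin n → ℕ} → σ ≗ σ′ → descents σ ≡ descents σ′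
descents-cong {zero}        σ≗σ′ = refl
descents-cong {suc zero}    σ≗σ′ = refl
descents-cong {suc (suc n)} σ≗σ′ =
  cong₂ (λ d ds → if d then 1 ∷ map suc ds else map suc ds)
        (cong₂ _<ᵇ_ (σ≗σ′ (suc zero)) (σ≗σ′ zero)) (descents-cong (σ≗σ′ ∘ suc))

module _ {n} (σ : Fin (suc (suc n)) → ℕ) where

  descents-ascent : σ zero ≤ σ (suc zero) → descents σ ≡ map suc (descents (σ ∘ suc))
  descents-ascent σ₀≤σ₁ with σ (suc zero) <ᵇ σ zero in eq
  ... | false = refl
  ... | true  = contradiction (<ᵇ⇒< _ _ (subst T (sym eq) tt)) (≤⇒≯ σ₀≤σ₁)

  descents-descent : σ (suc zero) < σ zero → descents σ ≡ 1 ∷ map suc (descents (σ ∘ suc))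
  descents-descent σ₁<σ₀ with σ (suc zero) <ᵇ σ zero in eq
  ... | true  = refl
  ... | false = contradiction (subst T eq (<⇒<ᵇ σ₁<σ₀)) (λ ())

descents-nondecreasing : ∀ {n} (s : ℕ → ℕ) → (∀ j → suc j < n → s j ≤ s (suc j)) →
  descents {n} (s ∘ toℕ) ≡ []
descents-nondecreasing {zero}        s ascent = refl
descents-nondecreasing {suc zero}    s ascent = refl
descents-nondecreasing {suc (suc n)} s ascent =
  trans (descents-ascent {n} (s ∘ toℕ) (ascent 0 (s≤s (s≤s z≤n))))
        (cong (map suc) (descents-nondecreasing {suc n} (s ∘ suc) (λ j j<n → ascent (suc j) (s≤s j<n))))

record UniqueDescent (n : ℕ) (s : ℕ → ℕ) (k : ℕ) : Set where
  field
    bound   : suc k < n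
    descent : s (suc k) < s k
    ascent  : ∀ j → suc j < n → j ≢ k → s j ≤ s (suc j)
open UniqueDescent

UniqueDescent-tail : ∀ {n s k} → UniqueDescent (suc n) s (suc k) → UniqueDescent n (s ∘ suc) k
UniqueDescent-tail u = record
  { bound   = ≤-pred (bound u)
  ; descent = descent u
  ; ascent  = λ j j<n j≢k → ascent u (suc j) (s≤s j<n) (j≢k ∘ suc-injective)
  }

descents-unique : ∀ {n s k} → UniqueDescent n s k → descents {n} (s ∘ toℕ) ≡ suc k ∷ []
descents-unique {suc zero} u with s≤s () ← bound u
descents-unique {suc (suc n)} {s} {zero} u =
  trans (descents-descent {n} (s ∘ toℕ) (descent u))
        (cong (λ ds → 1 ∷ map suc ds)
              (descents-nondecreasing {suc n} (s ∘ suc) (λ j j<n → ascent u (suc j) (s≤s j<n) (λ ()))))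
descents-unique {suc (suc n)} {s} {suc k} u =
  trans (descents-ascent {n} (s ∘ toℕ) (ascent u 0 (s≤s (s≤s z≤n)) (λ ())))
        (cong (map suc) (descents-unique {suc n} (UniqueDescent-tail u)))

shiftBlock : ℕ → (ℕ → ℕ) → ℕ → ℕ
shiftBlock zero    s y       = s y
shiftBlock (suc p) s zero    = zero
shiftBlock (suc p) s (suc y) = suc (shiftBlock p s y)

shiftBlock-< : ∀ p s {y} → y < p → shiftBlock p s y ≡ y
shiftBlock-< (suc p) s {zero}  _         = refl
shiftBlock-< (suc p) s {suc y} (s≤s y<p) = cong suc (shiftBlock-< p s y<p)

shiftBlock-+ : ∀ p s y → shiftBlock p s (p + y) ≡ p + s y
shiftBlock-+ zero    s y = refl
shiftBlock-+ (suc p) s y = cong suc (shiftBlock-+ p s y)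

shiftBlock-uniqueDescent : ∀ p {m s d} → UniqueDescent m s d →
  UniqueDescent (p + m) (shiftBlock p s) (p + d)
shiftBlock-uniqueDescent zero    u = u
shiftBlock-uniqueDescent (suc p) u = record
  { bound   = s≤s (bound u′)
  ; descent = s≤s (descent u′)
  ; ascent  = λ { zero    _          _   → z≤n
                ; (suc j) (s≤s j<pm) j≢k → s≤s (ascent u′ j j<pm (j≢k ∘ cong suc)) }
  }
  where
  u′ : UniqueDescent _ (shiftBlock p _) _
  u′ = shiftBlock-uniqueDescent p u

extend : ∀ {b} → Fn b → ℕ → ℕ
extend {b} ρ y with y <? b
... | yes y<b = toℕ (ρ (fromℕ< y<b))
... | no  _   = y

module _ {b} (ρ : Fn b) where

  extend-toℕ : ∀ j → extend ρ (toℕ j) ≡ toℕ (ρ j)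
  extend-toℕ j with toℕ j <? b
  ... | yes j<b = cong (toℕ ∘ ρ) (fromℕ<-toℕ j j<b)
  ... | no  j≮b = contradiction (toℕ<n j) j≮b

  extend-< : ∀ {y} → y < b → extend ρ y < b
  extend-< {y} y<b with y <? b
  ... | yes _   = toℕ<n _
  ... | no  y≮b = contradiction y<b y≮b

  extend-≥ : ∀ {y} → b ≤ y → extend ρ y ≡ y
  extend-≥ {y} b≤y with y <? b
  ... | yes y<b = contradiction y<b (≤⇒≯ b≤y)
  ... | no  _   = refl

  extend-uniqueDescent : ∀ r {d} → UniqueDescent b (extend ρ) d → UniqueDescent (b + r) (extend ρ) d
  extend-uniqueDescent r {d} u = record
    { bound   = ≤-trans (bound u) (m≤m+n b r)
    ; descent = descent u
    ; ascent  = ascent′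
    }
    where
    open ≤-Reasoning
    ascent′ : ∀ j → suc j < b + r → j ≢ d → extend ρ j ≤ extend ρ (suc j)
    ascent′ j _ j≢d with ≤-<-connex b (suc j) | ≤-<-connex b j
    ... | inj₂ sj<b | _        = ascent u j sj<b j≢d
    ... | inj₁ b≤sj | inj₂ j<b = begin
      extend ρ j       <⟨ extend-< j<b ⟩
      b                ≤⟨ b≤sj ⟩
      suc j            ≡⟨ extend-≥ b≤sj ⟨
      extend ρ (suc j) ∎
    ... | inj₁ b≤sj | inj₁ b≤j = begin
      extend ρ j       ≡⟨ extend-≥ b≤j ⟩
      j                ≤⟨ n≤1+n j ⟩
      suc j            ≡⟨ extend-≥ b≤sj ⟨
      extend ρ (suc j) ∎

shiftBlock-extend-outside : ∀ p {b} (ρ : Fn b) {y} → y < p ⊎ p + b ≤ y → shiftBlock p (extend ρ) y ≡ y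
shiftBlock-extend-outside p ρ (inj₁ y<p) = shiftBlock-< p (extend ρ) y<p
shiftBlock-extend-outside p {b} ρ (inj₂ p+b≤y) with m≤n⇒∃[o]m+o≡n (≤-trans (m≤m+n p b) p+b≤y)
... | z , refl = trans (shiftBlock-+ p (extend ρ) z) (cong (p +_) (extend-≥ ρ (+-cancelˡ-≤ p b z p+b≤y)))

MovesUp : ∀ {n} → ℕ → Fn n → Set
MovesUp i π = ∃ λ x → toℕ x ≡ i × toℕ x < toℕ (π x)

movesUp? : ∀ {n} i → Decidable (MovesUp {n} i)
movesUp? i π = any? (λ x → (toℕ x ≟ i) ×-dec (toℕ x <? toℕ (π x)))

MovesUp-resp : ∀ {n} i → MovesUp {n} i Respects _≗_
MovesUp-resp i π≗π′ (x , x≡i , x<πx) = x , x≡i , subst (toℕ x <_) (cong toℕ (π≗π′ x)) x<πx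

¬MovesUp-resp : ∀ {n} i → ∁ (MovesUp {n} i) Respects _≗_
¬MovesUp-resp {n} i = resp⇒¬-resp {P = MovesUp i} (Setoid.sym (Funs n n)) (MovesUp-resp i)

-- Fin (p + (b + r)) is the block p, …, p + b − 1 together with its complement,
-- which Fin (p + r) numbers in increasing order.
module _ (p r : ℕ) {b : ℕ} where

  toBlock : Fin (p + (b + r)) → Fin b ⊎ Fin (p + r)
  toBlock x with splitAt p x
  ... | inj₁ i = inj₂ (i ↑ˡ r)
  ... | inj₂ y with splitAt b y
  ...   | inj₁ j = inj₁ j
  ...   | inj₂ i = inj₂ (p ↑ʳ i)

  fromBlock : Fin b ⊎ Fin (p + r) → Fin (p + (b + r))
  fromBlock (inj₁ j) = p ↑ʳ (j ↑ˡ r)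
  fromBlock (inj₂ i) with splitAt p i
  ... | inj₁ i′ = i′ ↑ˡ (b + r)
  ... | inj₂ i′ = p ↑ʳ (b ↑ʳ i′)

  toBlock-fromBlock : ∀ y → toBlock (fromBlock y) ≡ y
  toBlock-fromBlock (inj₁ j) rewrite splitAt-↑ʳ p (b + r) (j ↑ˡ r) | splitAt-↑ˡ b j r = refl
  toBlock-fromBlock (inj₂ i) with splitAt p i in eq
  ... | inj₁ i′ rewrite splitAt-↑ˡ p i′ (b + r) = cong inj₂ (splitAt⁻¹-↑ˡ eq)
  ... | inj₂ i′ rewrite splitAt-↑ʳ p (b + r) (b ↑ʳ i′) | splitAt-↑ʳ b r i′ = cong inj₂ (splitAt⁻¹-↑ʳ eq)

  fromBlock-toBlock : ∀ x → fromBlock (toBlock x) ≡ x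
  fromBlock-toBlock x with splitAt p x in eq
  ... | inj₁ i rewrite splitAt-↑ˡ p i r = splitAt⁻¹-↑ˡ eq
  ... | inj₂ y with splitAt b y in eq′
  ...   | inj₁ j = trans (cong (p ↑ʳ_) (splitAt⁻¹-↑ˡ eq′)) (splitAt⁻¹-↑ʳ eq)
  ...   | inj₂ i rewrite splitAt-↑ʳ p r i = trans (cong (p ↑ʳ_) (splitAt⁻¹-↑ʳ eq′)) (splitAt⁻¹-↑ʳ eq)

  toℕ-fromBlock-inj₁ : ∀ j → toℕ (fromBlock (inj₁ j)) ≡ p + toℕ j
  toℕ-fromBlock-inj₁ j = trans (toℕ-↑ʳ p (j ↑ˡ r)) (cong (p +_) (toℕ-↑ˡ j r))

  toℕ-fromBlock-inj₂ : ∀ i → toℕ (fromBlock (inj₂ i)) < p ⊎ p + b ≤ toℕ (fromBlock (inj₂ i))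
  toℕ-fromBlock-inj₂ i with splitAt p i
  ... | inj₁ i′ = inj₁ (subst (_< p) (sym (toℕ-↑ˡ i′ (b + r))) (toℕ<n i′))
  ... | inj₂ i′ = inj₂ (begin
    p + b                ≤⟨ +-monoʳ-≤ p (m≤m+n b (toℕ i′)) ⟩
    p + (b + toℕ i′)     ≡⟨ cong (p +_) (toℕ-↑ʳ b i′) ⟨
    p + toℕ (b ↑ʳ i′)    ≡⟨ toℕ-↑ʳ p (b ↑ʳ i′) ⟨
    toℕ (p ↑ʳ (b ↑ʳ i′)) ∎)
    where open ≤-Reasoning

  insertBlock : Fn b → Fn (p + r) → Fn (p + (b + r))
  insertBlock c τ = fromBlock ∘ Sum.map c τ ∘ toBlock

  toBlock-insertBlock : ∀ c τ x → toBlock (insertBlock c τ x) ≡ Sum.map c τ (toBlock x)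
  toBlock-insertBlock c τ x = toBlock-fromBlock _

  insertBlock-fromBlock : ∀ c τ y → insertBlock c τ (fromBlock y) ≡ fromBlock (Sum.map c τ y)
  insertBlock-fromBlock c τ y = cong (fromBlock ∘ Sum.map c τ) (toBlock-fromBlock y)

  insertBlock-∘ : ∀ c c′ τ τ′ → insertBlock c τ ∘ insertBlock c′ τ′ ≗ insertBlock (c ∘ c′) (τ ∘ τ′)
  insertBlock-∘ c c′ τ τ′ x = cong fromBlock (begin
    Sum.map c τ (toBlock (insertBlock c′ τ′ x)) ≡⟨ cong (Sum.map c τ) (toBlock-insertBlock c′ τ′ x) ⟩
    Sum.map c τ (Sum.map c′ τ′ (toBlock x))     ≡⟨ Sum.map-map (toBlock x) ⟩
    Sum.map (c ∘ c′) (τ ∘ τ′) (toBlock x)       ∎)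
    where open ≡-Reasoning

  insertBlock-cong : ∀ {c c′ τ τ′} → c ≗ c′ → τ ≗ τ′ → insertBlock c τ ≗ insertBlock c′ τ′
  insertBlock-cong c≗c′ τ≗τ′ x = cong fromBlock (Sum.map-cong c≗c′ τ≗τ′ (toBlock x))

  insertBlock-id : insertBlock id id ≗ id
  insertBlock-id x = trans (cong fromBlock (Sum.map-id (toBlock x))) (fromBlock-toBlock x)

  insertBlock-isPerm : ∀ {c τ} → IsPerm c → IsPerm τ → IsPerm (insertBlock c τ)
  insertBlock-isPerm {c} {τ} c-perm τ-perm x x′ eq = begin
    x                      ≡⟨ fromBlock-toBlock x ⟨
    fromBlock (toBlock x)  ≡⟨ cong fromBlock (map-injective {toBlock x} {toBlock x′} (begin
      Sum.map c τ (toBlock x)      ≡⟨ toBlock-insertBlock c τ x ⟨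
      toBlock (insertBlock c τ x)  ≡⟨ cong toBlock eq ⟩
      toBlock (insertBlock c τ x′) ≡⟨ toBlock-insertBlock c τ x′ ⟩
      Sum.map c τ (toBlock x′)     ∎)) ⟩
    fromBlock (toBlock x′) ≡⟨ fromBlock-toBlock x′ ⟩
    x′                     ∎
    where
    open ≡-Reasoning
    map-injective : ∀ {y y′} → Sum.map c τ y ≡ Sum.map c τ y′ → y ≡ y′
    map-injective {inj₁ j} {inj₁ j′} eq = cong inj₁ (c-perm j j′ (Sum.inj₁-injective eq))
    map-injective {inj₂ i} {inj₂ i′} eq = cong inj₂ (τ-perm i i′ (Sum.inj₂-injective eq))

  insertBlock-involutive : ∀ {c τ} → IsInvolution c → IsInvolution τ → IsInvolution (insertBlock c τ)
  insertBlock-involutive {c} {τ} c-inv τ-inv x =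
    trans (insertBlock-∘ c c τ τ x) (trans (insertBlock-cong c-inv τ-inv x) (insertBlock-id x))

  insertBlock-square : ∀ c {τ} → IsInvolution τ → insertBlock c τ ∘ insertBlock c τ ≗ insertBlock (c ∘ c) id
  insertBlock-square c {τ} τ-inv x = trans (insertBlock-∘ c c τ τ x) (insertBlock-cong (λ _ → refl) τ-inv x)

  insertBlock-injectiveʳ : ∀ c {τ τ′} → insertBlock c τ ≗ insertBlock c τ′ → τ ≗ τ′
  insertBlock-injectiveʳ c {τ} {τ′} eq i = Sum.inj₂-injective (begin
    inj₂ (τ i)                                      ≡⟨ on-complement τ ⟨
    toBlock (insertBlock c τ (fromBlock (inj₂ i)))  ≡⟨ cong toBlock (eq (fromBlock (inj₂ i))) ⟩
    toBlock (insertBlock c τ′ (fromBlock (inj₂ i))) ≡⟨ on-complement τ′ ⟩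
    inj₂ (τ′ i)                                     ∎)
    where
    open ≡-Reasoning
    on-complement : ∀ σ → toBlock (insertBlock c σ (fromBlock (inj₂ i))) ≡ inj₂ (σ i)
    on-complement σ = trans (cong toBlock (insertBlock-fromBlock c σ (inj₂ i))) (toBlock-fromBlock _)

  toℕ-insertBlock-id : ∀ ρ x → toℕ (insertBlock ρ id x) ≡ shiftBlock p (extend ρ) (toℕ x)
  toℕ-insertBlock-id ρ x = begin
    toℕ (insertBlock ρ id x)
      ≡⟨ cong (toℕ ∘ insertBlock ρ id) (fromBlock-toBlock x) ⟨
    toℕ (insertBlock ρ id (fromBlock (toBlock x)))
      ≡⟨ cong toℕ (insertBlock-fromBlock ρ id (toBlock x)) ⟩
    toℕ (fromBlock (Sum.map ρ id (toBlock x)))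
      ≡⟨ on (toBlock x) ⟩
    shiftBlock p (extend ρ) (toℕ (fromBlock (toBlock x)))
      ≡⟨ cong (shiftBlock p (extend ρ) ∘ toℕ) (fromBlock-toBlock x) ⟩
    shiftBlock p (extend ρ) (toℕ x)
      ∎
    where
    open ≡-Reasoning
    on : ∀ y → toℕ (fromBlock (Sum.map ρ id y)) ≡ shiftBlock p (extend ρ) (toℕ (fromBlock y))
    on (inj₁ j) = begin
      toℕ (fromBlock (inj₁ (ρ j)))        ≡⟨ toℕ-fromBlock-inj₁ (ρ j) ⟩
      p + toℕ (ρ j)                       ≡⟨ cong (p +_) (extend-toℕ ρ j) ⟨
      p + extend ρ (toℕ j)                ≡⟨ shiftBlock-+ p (extend ρ) (toℕ j) ⟨
      shiftBlock p (extend ρ) (p + toℕ j) ≡⟨ cong (shiftBlock p (extend ρ)) (toℕ-fromBlock-inj₁ j) ⟨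
      shiftBlock p (extend ρ) (toℕ (fromBlock (inj₁ j))) ∎
    on (inj₂ i) = sym (shiftBlock-extend-outside p ρ (toℕ-fromBlock-inj₂ i))

  insertBlock-oneDescentAt : ∀ c {τ d} → UniqueDescent b (extend (c ∘ c)) d → IsInvolution τ →
    OneDescentAt (suc (d + p)) (insertBlock c τ)
  insertBlock-oneDescentAt c {τ} {d} c²-descent τ-inv = begin
    descents (toℕ ∘ insertBlock c τ ∘ insertBlock c τ)           ≡⟨ descents-cong square ⟩
    descents {p + (b + r)} (shiftBlock p (extend (c ∘ c)) ∘ toℕ) ≡⟨ descents-unique
      (shiftBlock-uniqueDescent p (extend-uniqueDescent (c ∘ c) r c²-descent)) ⟩
    suc (p + d) ∷ []                                             ≡⟨ cong (λ k → suc k ∷ []) (+-comm p d) ⟩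
    suc (d + p) ∷ []                                             ∎
    where
    open ≡-Reasoning
    square : toℕ ∘ insertBlock c τ ∘ insertBlock c τ ≗ shiftBlock p (extend (c ∘ c)) ∘ toℕ
    square x = trans (cong toℕ (insertBlock-square c τ-inv x)) (toℕ-insertBlock-id (c ∘ c) x)

  insertBlock-movesUp⇔ : ∀ c τ j → MovesUp (toℕ j + p) (insertBlock c τ) ⇔ toℕ j < toℕ (c j)
  insertBlock-movesUp⇔ c τ j = mk⇔ to from
    where
    x₀ : Fin (p + (b + r))
    x₀ = fromBlock (inj₁ j)

    toℕ-x₀ : toℕ x₀ ≡ toℕ j + p
    toℕ-x₀ = trans (toℕ-fromBlock-inj₁ j) (+-comm p (toℕ j))

    toℕ-πx₀ : toℕ (insertBlock c τ x₀) ≡ p + toℕ (c j)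
    toℕ-πx₀ = trans (cong toℕ (insertBlock-fromBlock c τ (inj₁ j))) (toℕ-fromBlock-inj₁ (c j))

    to : MovesUp (toℕ j + p) (insertBlock c τ) → toℕ j < toℕ (c j)
    to (x , x≡ , x<πx) with toℕ-injective {i = x} {j = x₀} (trans x≡ (sym toℕ-x₀))
    ... | refl = +-cancelˡ-< p (toℕ j) (toℕ (c j))
      (subst₂ _<_ (trans toℕ-x₀ (+-comm (toℕ j) p)) toℕ-πx₀ x<πx)

    from : toℕ j < toℕ (c j) → MovesUp (toℕ j + p) (insertBlock c τ)
    from j<cj = x₀ , toℕ-x₀ , subst₂ _<_ (sym (toℕ-fromBlock-inj₁ j)) (sym toℕ-πx₀) (+-monoʳ-< p j<cj)

insertBlock-count : ∀ p r {b} (c : Fn b) {ℓ₁ ℓ₂}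
  {P : Pred (Fn (p + (b + r))) ℓ₁} {Q : Pred (Fn (p + (b + r))) ℓ₂} (P? : Decidable P) (Q? : Decidable Q) →
  P Respects _≗_ → Q Respects _≗_ →
  (∀ τ → IsInvolution τ → P (insertBlock p r c τ) × Q (insertBlock p r c τ)) →
  e (p + r) ≤ length (filter Q? (filter P? (allFuns (p + (b + r)) (p + (b + r)))))
insertBlock-count p r c P? Q? P-resp Q-resp PQ =
  e≤length (insertBlock p r c) (insertBlock-injectiveʳ p r c)
  (λ τ τ-inv → ∈-filter⁺ (Funs _ _) Q? Q-resp
    (∈-filter-allFuns P? P-resp (proj₁ (PQ τ τ-inv))) (proj₂ (PQ τ τ-inv)))

swap₂ : Fn 2
swap₂ 0F = 1F
swap₂ 1F = 0F

swap₂-involutive : IsInvolution swap₂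
swap₂-involutive 0F = refl
swap₂-involutive 1F = refl

e+e≤e[2+m] : ∀ m → e m + e m ≤ e (2 + m)
e+e≤e[2+m] m = begin
  e m + e m                                                  ≤⟨ +-mono-≤ swap-family id-family ⟩
  length (filter Q? invs) + length (filter (∁? Q?) invs) ≡⟨ length-filter-∁ Q? invs ⟩
  e (2 + m)                                                  ∎
  where
  open ≤-Reasoning
  invs : List (Fn (2 + m))
  invs = involutions (2 + m)

  Q? : Decidable (MovesUp {2 + m} 0)
  Q? = movesUp? 0

  involution : ∀ {c τ} → IsInvolution c → IsInvolution τ →
    IsPerm (insertBlock 0 m c τ) × IsInvolution (insertBlock 0 m c τ)
  involution c-inv τ-inv = involution⇒isPerm π-inv , π-inv
    where π-inv = insertBlock-involutive 0 m c-inv τ-inv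

  swap-family : e m ≤ length (filter Q? invs)
  swap-family = insertBlock-count 0 m swap₂ involution? Q? involution-resp (MovesUp-resp 0)
    (λ τ τ-inv → involution swap₂-involutive τ-inv ,
                 Equivalence.from (insertBlock-movesUp⇔ 0 m swap₂ τ 0F) (s≤s z≤n))

  id-family : e m ≤ length (filter (∁? Q?) invs)
  id-family = insertBlock-count 0 m id involution? (∁? Q?) involution-resp (¬MovesUp-resp 0)
    (λ τ τ-inv → involution (λ _ → refl) τ-inv ,
                 (λ ()) ∘ Equivalence.to (insertBlock-movesUp⇔ 0 m id τ 0F))

lowerBound-step : ∀ m → lowerBound (3 + m) ≡ e m + lowerBound (1 + m)
lowerBound-step m rewrite m/n≡1+[m∸n]/n {2 + m} {2} (s≤s (s≤s z≤n)) = cong (e m +_) (cong sum (begin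
  map term (map suc (applyUpTo suc (m / 2)))                   ≡⟨ cong (map term ∘ map suc) (map-upTo suc (m / 2)) ⟨
  map term (map suc (map suc (upTo (m / 2))))                  ≡⟨ map-∘ (map suc (upTo (m / 2))) ⟨
  map (term ∘ suc) (map suc (upTo (m / 2)))                    ≡⟨ map-cong term-suc (map suc (upTo (m / 2))) ⟩
  map (λ i → e (1 + m ∸ (2 * i + 1))) (map suc (upTo (m / 2))) ∎))
  where
  open ≡-Reasoning
  term : ℕ → ℕ
  term i = e (3 + m ∸ (2 * i + 1))

  term-suc : ∀ i → term (suc i) ≡ e (1 + m ∸ (2 * i + 1))
  term-suc i = cong (λ j → e (3 + m ∸ (j + 1))) (*-distribˡ-+ 2 1 i)

lowerBound-suc≤e : ∀ m → lowerBound (suc m) ≤ e m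
lowerBound-suc≤e zero          = z≤n
lowerBound-suc≤e (suc zero)    = z≤n
lowerBound-suc≤e (suc (suc m)) = begin
  lowerBound (3 + m)       ≡⟨ lowerBound-step m ⟩
  e m + lowerBound (1 + m) ≤⟨ +-monoʳ-≤ (e m) (lowerBound-suc≤e m) ⟩
  e m + e m                ≤⟨ e+e≤e[2+m] m ⟩
  e (2 + m)                ∎
  where open ≤-Reasoning

oneDescentSq? : ∀ {n} k → Decidable (λ (π : Fn n) → IsPerm π × OneDescentAt k π)
oneDescentSq? k π = isPerm? π ×-dec oneDescentAt? k π

oneDescentSq-resp : ∀ {n} k → (λ (π : Fn n) → IsPerm π × OneDescentAt k π) Respects _≗_
oneDescentSq-resp k {π} {π′} π≗π′ (π-perm , π-descent) = IsPerm-resp π≗π′ π-perm ,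
  trans (descents-cong (λ x → cong toℕ (sym (trans (cong π (π≗π′ x)) (π≗π′ (π′ x)))))) π-descent

insertBlock-count-oneDescentSq : ∀ p r {b} {c : Fn b} {d ℓ} {Q : Pred (Fn (p + (b + r))) ℓ}
  (Q? : Decidable Q) → Q Respects _≗_ → IsPerm c → UniqueDescent b (extend (c ∘ c)) d →
  (∀ τ → Q (insertBlock p r c τ)) →
  e (p + r) ≤ length (filter Q? (filter (oneDescentSq? (suc (d + p))) (allFuns (p + (b + r)) (p + (b + r)))))
insertBlock-count-oneDescentSq p r {c = c} Q? Q-resp c-perm c²-descent Q-insertBlock =
  insertBlock-count p r c (oneDescentSq? _) Q? (oneDescentSq-resp _) Q-resp
    (λ τ τ-inv → (insertBlock-isPerm p r c-perm (involution⇒isPerm τ-inv) ,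
                  insertBlock-oneDescentAt p r c c²-descent τ-inv) , Q-insertBlock τ)

rot : Fn 3
rot 0F = 1F
rot 1F = 2F
rot 2F = 0F

rot⁻¹ : Fn 3
rot⁻¹ 0F = 2F
rot⁻¹ 1F = 0F
rot⁻¹ 2F = 1F

rot⁻¹-rot : ∀ i → rot⁻¹ (rot i) ≡ i
rot⁻¹-rot 0F = refl
rot⁻¹-rot 1F = refl
rot⁻¹-rot 2F = refl

rot-rot⁻¹ : ∀ i → rot (rot⁻¹ i) ≡ i
rot-rot⁻¹ 0F = refl
rot-rot⁻¹ 1F = refl
rot-rot⁻¹ 2F = refl

rot²-uniqueDescent : UniqueDescent 3 (extend (rot ∘ rot)) 0
rot²-uniqueDescent = record
  { bound   = s≤s (s≤s z≤n)
  ; descent = s≤s z≤n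
  ; ascent  = λ { 0 _ 0≢0 → contradiction refl 0≢0
                ; 1 _ _   → z≤n
                ; (suc (suc _)) (s≤s (s≤s (s≤s ()))) _ }
  }

rot⁻²-uniqueDescent : UniqueDescent 3 (extend (rot⁻¹ ∘ rot⁻¹)) 1
rot⁻²-uniqueDescent = record
  { bound   = ≤-refl
  ; descent = s≤s z≤n
  ; ascent  = λ { 0 _ _   → s≤s z≤n
                ; 1 _ 1≢1 → contradiction refl 1≢1
                ; (suc (suc _)) (s≤s (s≤s (s≤s ()))) _ }
  }

e+e≤countOneDescentSq : ∀ {m q} → q < m → e m + e m ≤ countOneDescentSq (3 + m) (2 + q)
e+e≤countOneDescentSq {q = q} q<m with m≤n⇒∃[o]m+o≡n q<m
... | r , refl = begin
  e (suc q + r) + e (suc q + r)                               ≤⟨ +-mono-≤ upward downward ⟩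
  length (filter Q? (ys N)) + length (filter (∁? Q?) (ys N)) ≡⟨ length-filter-∁ Q? (ys N) ⟩
  countOneDescentSq N (2 + q)                                 ∎
  where
  open ≤-Reasoning
  N : ℕ
  N = 3 + (suc q + r)

  Q? : ∀ {n} → Decidable (MovesUp {n} (suc q))
  Q? = movesUp? (suc q)

  ys : ∀ n → List (Fn n)
  ys n = filter (oneDescentSq? (2 + q)) (allFuns n n)

  upward : e (suc q + r) ≤ length (filter Q? (ys N))
  upward = subst (λ n → e (suc q + r) ≤ length (filter Q? (ys n))) (x∙yz≈y∙xz (suc q) 3 r)
    (insertBlock-count-oneDescentSq (suc q) r Q? (MovesUp-resp (suc q))
      (leftInverse⇒isPerm {g = rot⁻¹} rot⁻¹-rot) rot²-uniqueDescent
      (λ τ → Equivalence.from (insertBlock-movesUp⇔ (suc q) r rot τ 0F) (s≤s z≤n)))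

  downward : e (suc q + r) ≤ length (filter (∁? Q?) (ys N))
  downward = subst₂ (λ m n → e m ≤ length (filter (∁? Q?) (ys n)))
    (+-suc q r) (trans (x∙yz≈y∙xz q 3 (suc r)) (cong (3 +_) (+-suc q r)))
    (insertBlock-count-oneDescentSq q (suc r) (∁? Q?) (¬MovesUp-resp (suc q))
      (leftInverse⇒isPerm {g = rot} rot-rot⁻¹) rot⁻²-uniqueDescent
      (λ τ → (λ ()) ∘ Equivalence.to (insertBlock-movesUp⇔ q (suc r) rot⁻¹ τ 1F)))

proposition4p4 : (n k : ℕ) → 4 ≤ n → 2 ≤ k → k ≤ n ∸ 2 →
    lowerBound n ≤ countOneDescentSq n k
proposition4p4 (suc (suc (suc (suc m)))) (suc (suc q))
               (s≤s (s≤s (s≤s (s≤s _)))) (s≤s (s≤s _)) (s≤s (s≤s q≤m)) = begin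
  lowerBound (4 + m)                ≡⟨ lowerBound-step (suc m) ⟩
  e (suc m) + lowerBound (2 + m)    ≤⟨ +-monoʳ-≤ (e (suc m)) (lowerBound-suc≤e (suc m)) ⟩
  e (suc m) + e (suc m)             ≤⟨ e+e≤countOneDescentSq (s≤s q≤m) ⟩
  countOneDescentSq (4 + m) (2 + q) ∎
  where open ≤-Reasoning
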